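{- Let $n$ be an even integer and let $x$ be an integer with $6 \le x \le n-4$. Let $d$ be the sequence of length $n$ $$d = (n-1,\, n-1,\, n-1,\, \underbrace{x, \ldots, x}_{n-6 \text{ times}},\, 3,\, 3,\, 3).$$ Then $d$ is a $3$-factorable graphic sequence, and $d$ has no connected $3$-factor, i.e. there is no graph with degree sequence $d$ containing a connected $3$-regular spanning subgraph.
   Context: A finite nonincreasing sequence of positive integers $d=(d_1,\ldots,d_n)$ is graphic if there is a simple graph on vertices $v_1,\ldots,v_n$ with $\deg(v_i)=d_i$ for all $i$; such a graph is a realization of $d$. A graphic sequence $d$ is $k$-factorable if some realization of $d$ contains a $k$-factor, i.e. a $k$-regular spanning subgraph. A $k$-factor is connected if it is a connected graph. "$d$ has no connected $k$-factor" means no realization of $d$ contains a connected $k$-factor. -}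

module Defs where

open import Data.Nat using (ℕ; zero; suc; _+_; _∸_; _<_; _≤_)
open import Data.Nat.Properties using (_<?_)
open import Data.Bool using (Bool; true; false)
open import Data.Fin using (Fin; toℕ)
open import Data.Fin.Subset using (Subset; ∣_∣)
open import Data.Vec using (tabulate)
open import Data.Product using (Σ; ∃; _×_; _,_)
open import Relation.Nullary using (¬_; does)
open import Relation.Binary.PropositionalEquality using (_≡_)

record Graph (n : ℕ) : Set where
  field
    adj   : Fin n → Fin n → Bool
    sym   : ∀ i j → adj i j ≡ adj j i
    loopless : ∀ i → adj i i ≡ false
open Graph public

nbhd : ∀ {n} → Graph n → Fin n → Subset n
nbhd G i = tabulate (adj G i)

deg : ∀ {n} → Graph n → Fin n → ℕ
deg G i = ∣ nbhd G i ∣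

_⊆G_ : ∀ {n} → Graph n → Graph n → Set
H ⊆G G = ∀ i j → adj H i j ≡ true → adj G i j ≡ true

Regular : ∀ {n} → ℕ → Graph n → Set
Regular k H = ∀ i → deg H i ≡ k

data Walk {n} (G : Graph n) : Fin n → Fin n → Set where
  here : ∀ {u} → Walk G u u
  step : ∀ {u v w} → adj G u v ≡ true → Walk G v w → Walk G u w

Connected : ∀ {n} → Graph n → Set
Connected G = ∀ u v → Walk G u v

Realizes : ∀ {n} → Graph n → (Fin n → ℕ) → Set
Realizes G d = ∀ i → deg G i ≡ d i

Graphic : ∀ {n} → (Fin n → ℕ) → Set
Graphic {n} d = Σ (Graph n) λ G → Realizes G d

HasFactor : ∀ {n} → ℕ → Graph n → Set
HasFactor {n} k G = Σ (Graph n) λ H → H ⊆G G × Regular k H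

HasConnectedFactor : ∀ {n} → ℕ → Graph n → Set
HasConnectedFactor {n} k G = Σ (Graph n) λ H → H ⊆G G × Regular k H × Connected H

Factorable : ∀ {n} → ℕ → (Fin n → ℕ) → Set
Factorable {n} k d = Σ (Graph n) λ G → Realizes G d × HasFactor k G

NoConnectedFactor : ∀ {n} → ℕ → (Fin n → ℕ) → Set
NoConnectedFactor {n} k d = ∀ (G : Graph n) → Realizes G d → ¬ HasConnectedFactor k G

dSeq : (n x : ℕ) → Fin n → ℕ
dSeq n x i with does (toℕ i <? 3) | does (toℕ i <? n ∸ 3)
... | true  | _     = n ∸ 1
... | false | true  = x
... | false | false = 3

-- The three hubs (degree n - 1) are adjacent to every vertex, so each of the three leaves (degree 3)
-- sees exactly the hubs. A 3-factor must keep all three edges at every leaf, and these already give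
-- each hub its three factor edges; so hubs and leaves form a union of components of any 3-factor,
-- which misses the n - 6 middle vertices.
-- For a 3-factorable realization, join the hubs to everything and put on the middle vertices an
-- (x - 3)-regular graph containing a cubic subgraph. Writing x - 3 = 2k or 2k + 1, the circulant on
-- ℤ/(n - 6) with distances 1, …, k, plus the antipodal distance when x - 3 is odd, does: for x - 3 = 3
-- it is cubic itself, and otherwise it contains the ladder formed by the matching {2i, 2i + 1} and
-- the edges at distance 2.
module Submission where

open import Defs hiding (sym)
open import Data.Nat using (ℕ; _≤_; _+_; _*_)
open import Data.Product using (_×_; ∃)
open import Relation.Binary.PropositionalEquality using (_≡_)

open import Data.Nat using (zero; suc; _∸_; _<_; _⊓_; _≡ᵇ_; _<ᵇ_; ∣_-_∣; z≤n; s≤s)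
open import Data.Nat.Properties
open import Data.Nat.Tactic.RingSolver using (solve-∀)
open import Data.Product using (_,_)
open import Data.Sum using (_⊎_; inj₁; inj₂; [_,_]′)
open import Data.Bool using (Bool; true; false; not; _∧_; _∨_)
open import Data.Bool.Properties using (T-≡; ∧-zeroʳ)
open import Data.Fin using (Fin; toℕ) renaming (zero to fzero; suc to fsuc)
open import Data.Vec using (tabulate)
open import Data.Fin.Subset using (Subset; ∣_∣; _∈_; _∉_; _⊆_; ∁; ⁅_⁆)
open import Data.Fin.Subset.Properties
  using (_∈?_; p⊂q⇒∣p∣<∣q∣; x∉p⇒x∈∁p; x≢y⇒x∉⁅y⁆; x∈⁅y⁆⇒x≡y; ∣∁p∣≡n∸∣p∣; ∣⁅x⁆∣≡1)
open import Data.Vec.Properties using (lookup∘tabulate; lookup⇒[]=; []=⇒lookup)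
open import Relation.Nullary using (Dec; does; yes; no; contradiction)
open import Relation.Nullary.Decidable using (dec-true; dec-false)
open import Relation.Binary.PropositionalEquality
  using (refl; sym; trans; cong; cong₂; subst; subst₂; _≢_; module ≡-Reasoning)
open import Function using (_∘_)
open import Function.Bundles using (Equivalence)

⟦_⟧ : Bool → ℕ
⟦ true  ⟧ = 1
⟦ false ⟧ = 0

count : ℕ → (ℕ → Bool) → ℕ
count zero    g = 0
count (suc k) g = ⟦ g 0 ⟧ + count k (g ∘ suc)

count-cong : ∀ k {f g : ℕ → Bool} → (∀ t → t < k → f t ≡ g t) → count k f ≡ count k g
count-cong zero    f≗g = refl
count-cong (suc k) f≗g =
  cong₂ _+_ (cong ⟦_⟧ (f≗g 0 (s≤s z≤n))) (count-cong k (λ t t<k → f≗g (suc t) (s≤s t<k)))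

count-true : ∀ k → count k (λ _ → true) ≡ k
count-true zero    = refl
count-true (suc k) = cong suc (count-true k)

count-false : ∀ k → count k (λ _ → false) ≡ 0
count-false zero    = refl
count-false (suc k) = count-false k

count-+ : ∀ k l (g : ℕ → Bool) → count (k + l) g ≡ count k g + count l (λ t → g (k + t))
count-+ zero    l g = refl
count-+ (suc k) l g = trans (cong (⟦ g 0 ⟧ +_) (count-+ k l (g ∘ suc))) (sym (+-assoc ⟦ g 0 ⟧ _ _))

count-last : ∀ k (g : ℕ → Bool) → count (suc k) g ≡ count k g + ⟦ g k ⟧
count-last zero    g = +-comm ⟦ g 0 ⟧ 0
count-last (suc k) g = begin
  ⟦ g 0 ⟧ + count (suc k) (g ∘ suc)       ≡⟨ cong (⟦ g 0 ⟧ +_) (count-last k (g ∘ suc)) ⟩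
  ⟦ g 0 ⟧ + (count k (g ∘ suc) + ⟦ g (suc k) ⟧) ≡⟨ sym (+-assoc ⟦ g 0 ⟧ _ _) ⟩
  count (suc k) g + ⟦ g (suc k) ⟧         ∎
  where open ≡-Reasoning

count-reverse : ∀ k (g : ℕ → Bool) → count k (λ t → g (k ∸ t)) ≡ count k (g ∘ suc)
count-reverse zero    g = refl
count-reverse (suc k) g = begin
  ⟦ g (suc k) ⟧ + count k (λ t → g (k ∸ t)) ≡⟨ cong (⟦ g (suc k) ⟧ +_) (count-reverse k g) ⟩
  ⟦ g (suc k) ⟧ + count k (g ∘ suc)         ≡⟨ +-comm ⟦ g (suc k) ⟧ _ ⟩
  count k (g ∘ suc) + ⟦ g (suc k) ⟧         ≡⟨ sym (count-last k (g ∘ suc)) ⟩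
  count (suc k) (g ∘ suc)                   ∎
  where open ≡-Reasoning

count-∨ : ∀ k (f g : ℕ → Bool) → (∀ t → f t ≡ true → g t ≡ false) →
          count k (λ t → f t ∨ g t) ≡ count k f + count k g
count-∨ zero    f g disjoint = refl
count-∨ (suc k) f g disjoint with f 0 in f0 | g 0 in g0
... | true  | true  with () ← trans (sym g0) (disjoint 0 f0)
... | true  | false = cong suc (count-∨ k (f ∘ suc) (g ∘ suc) (disjoint ∘ suc))
... | false | true  = trans (cong suc (count-∨ k (f ∘ suc) (g ∘ suc) (disjoint ∘ suc))) (sym (+-suc _ _))
... | false | false = count-∨ k (f ∘ suc) (g ∘ suc) (disjoint ∘ suc)

count-<ᵇ : ∀ {k l} → k ≤ l → count l (_<ᵇ k) ≡ k
count-<ᵇ {zero}  {l}     _         = count-false l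
count-<ᵇ {suc k} {suc l} (s≤s k≤l) = cong suc (count-<ᵇ k≤l)

count-≡ᵇ : ∀ {c l} → c < l → count l (c ≡ᵇ_) ≡ 1
count-≡ᵇ {zero}  {suc l} _         = cong suc (count-false l)
count-≡ᵇ {suc c} {suc l} (s≤s c<l) = count-≡ᵇ c<l

count-≡ᵇ-outside : ∀ {c l} → l ≤ c → count l (c ≡ᵇ_) ≡ 0
count-≡ᵇ-outside {c}     {zero}  _         = refl
count-≡ᵇ-outside {suc c} {suc l} (s≤s l≤c) = count-≡ᵇ-outside l≤c

∣tabulate∣≡count : ∀ n (g : ℕ → Bool) → ∣ tabulate (g ∘ toℕ {n}) ∣ ≡ count n g
∣tabulate∣≡count zero    g = refl
∣tabulate∣≡count (suc n) g with g 0
... | true  = cong suc (∣tabulate∣≡count n (g ∘ suc))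
... | false = ∣tabulate∣≡count n (g ∘ suc)

≡ᵇ-refl : ∀ i → (i ≡ᵇ i) ≡ true
≡ᵇ-refl i = dec-true (i ≟ i) refl

≡ᵇ-sym : ∀ i j → (i ≡ᵇ j) ≡ (j ≡ᵇ i)
≡ᵇ-sym i j with i ≟ j
... | yes refl = refl
... | no  i≢j  = trans (dec-false (i ≟ j) i≢j) (sym (dec-false (j ≟ i) (i≢j ∘ sym)))

record Simple (A : ℕ → ℕ → Bool) : Set where
  field
    symmetric   : ∀ p q → A p q ≡ A q p
    irreflexive : ∀ p → A p p ≡ false

RegularOn : ℕ → ℕ → (ℕ → ℕ → Bool) → Set
RegularOn m r A = ∀ p → p < m → count m (A p) ≡ r

_⊆ᴬ_ : (ℕ → ℕ → Bool) → (ℕ → ℕ → Bool) → Set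
A ⊆ᴬ B = ∀ p q → A p q ≡ true → B p q ≡ true

toGraph : ∀ n (A : ℕ → ℕ → Bool) → Simple A → Graph n
toGraph n A simple = record
  { adj      = λ i j → A (toℕ i) (toℕ j)
  ; sym      = λ i j → Simple.symmetric simple (toℕ i) (toℕ j)
  ; loopless = λ i → Simple.irreflexive simple (toℕ i)
  }

deg-toGraph : ∀ {n} A (simple : Simple A) i → deg (toGraph n A simple) i ≡ count n (A (toℕ i))
deg-toGraph {n} A _ i = ∣tabulate∣≡count n (A (toℕ i))

_∪ᴬ_ : (ℕ → ℕ → Bool) → (ℕ → ℕ → Bool) → ℕ → ℕ → Bool
(A ∪ᴬ B) p q = A p q ∨ B p q

∪ᴬ-simple : ∀ {A B} → Simple A → Simple B → Simple (A ∪ᴬ B)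
∪ᴬ-simple A-simple B-simple = record
  { symmetric   = λ p q → cong₂ _∨_ (Simple.symmetric A-simple p q) (Simple.symmetric B-simple p q)
  ; irreflexive = λ p → cong₂ _∨_ (Simple.irreflexive A-simple p) (Simple.irreflexive B-simple p)
  }

∪ᴬ-⊆ : ∀ {A B C} → A ⊆ᴬ C → B ⊆ᴬ C → (A ∪ᴬ B) ⊆ᴬ C
∪ᴬ-⊆ {A} A⊆C B⊆C p q e with A p q in Apq
... | true  = A⊆C p q Apq
... | false = B⊆C p q e

m∸[n∸o]≡m∸n+o : ∀ {m n o} → n ≤ m → o ≤ n → m ∸ (n ∸ o) ≡ m ∸ n + o
m∸[n∸o]≡m∸n+o {m} {n} {o} n≤m o≤n = begin
  m ∸ (n ∸ o)           ≡⟨ cong (_∸ (n ∸ o)) (sym (m∸n+n≡m n≤m)) ⟩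
  (m ∸ n + n) ∸ (n ∸ o) ≡⟨ +-∸-assoc (m ∸ n) (m∸n≤m n o) ⟩
  m ∸ n + (n ∸ (n ∸ o)) ≡⟨ cong (m ∸ n +_) (m∸[m∸n]≡n o≤n) ⟩
  m ∸ n + o             ∎
  where open ≡-Reasoning

-- For p ≤ q < m the difference ∣ p - q ∣ runs through 0, …, m - 1 - p; for q < p the symmetry of S
-- trades p - q for m - p + q, which runs through the remaining values.
count-rotate : ∀ m (S : ℕ → Bool) → (∀ d → d ≤ m → S d ≡ S (m ∸ d)) →
               ∀ p → p ≤ m → count m (λ q → S ∣ p - q ∣) ≡ count m S
count-rotate m S S-sym p p≤m = begin
  count m (λ q → S ∣ p - q ∣)
    ≡⟨ cong (λ n → count n (λ q → S ∣ p - q ∣)) (sym (m+[n∸m]≡n p≤m)) ⟩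
  count (p + (m ∸ p)) (λ q → S ∣ p - q ∣)
    ≡⟨ count-+ p (m ∸ p) (λ q → S ∣ p - q ∣) ⟩
  count p (λ q → S ∣ p - q ∣) + count (m ∸ p) (λ t → S ∣ p - p + t ∣)
    ≡⟨ cong₂ _+_ (count-cong p below) (count-cong (m ∸ p) (λ t _ → cong S (∣m-m+n∣≡n p t))) ⟩
  count p (λ q → S (m ∸ p + q)) + count (m ∸ p) S
    ≡⟨ +-comm _ (count (m ∸ p) S) ⟩
  count (m ∸ p) S + count p (λ q → S (m ∸ p + q))
    ≡⟨ sym (count-+ (m ∸ p) p S) ⟩
  count (m ∸ p + p) S
    ≡⟨ cong (λ n → count n S) (m∸n+n≡m p≤m) ⟩
  count m S
    ∎
  where
  open ≡-Reasoning
  below : ∀ q → q < p → S ∣ p - q ∣ ≡ S (m ∸ p + q)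
  below q q<p = begin
    S ∣ p - q ∣       ≡⟨ cong S (m≤n⇒∣n-m∣≡n∸m (<⇒≤ q<p)) ⟩
    S (p ∸ q)         ≡⟨ S-sym (p ∸ q) (≤-trans (m∸n≤m p q) p≤m) ⟩
    S (m ∸ (p ∸ q))   ≡⟨ cong S (m∸[n∸o]≡m∸n+o p≤m (<⇒≤ q<p)) ⟩
    S (m ∸ p + q)     ∎

-- For p, q < m, cyclic m ∣ p - q ∣ is the distance from p to q around the m-cycle.
cyclic : ℕ → ℕ → ℕ
cyclic m d = d ⊓ (m ∸ d)

cyclic-sym : ∀ m d → d ≤ m → cyclic m d ≡ cyclic m (m ∸ d)
cyclic-sym m d d≤m = trans (⊓-comm d (m ∸ d)) (cong ((m ∸ d) ⊓_) (sym (m∸[m∸n]≡n d≤m)))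

circulant : ℕ → (ℕ → Bool) → ℕ → ℕ → Bool
circulant m T p q = T (cyclic m ∣ p - q ∣)

circulant-simple : ∀ m T → T 0 ≡ false → Simple (circulant m T)
circulant-simple m T T0≡false = record
  { symmetric   = λ p q → cong (T ∘ cyclic m) (∣-∣-comm p q)
  ; irreflexive = λ p → trans (cong (T ∘ cyclic m) (∣n-n∣≡0 p)) T0≡false
  }

circulant-mono : ∀ m {T T′} → (∀ d → T d ≡ true → T′ d ≡ true) → circulant m T ⊆ᴬ circulant m T′
circulant-mono m T⊆T′ p q = T⊆T′ _

count-circulant : ∀ m T p → p < m → count m (circulant m T p) ≡ count m (T ∘ cyclic m)
count-circulant m T p p<m =
  count-rotate m (T ∘ cyclic m) (λ d d≤m → cong T (cyclic-sym m d d≤m)) p (<⇒≤ p<m)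

-- Around a cycle of length 2 + h + h each distance 1, …, h occurs twice, the antipodal distance 1 + h once.
count-cyclic : ∀ h (T : ℕ → Bool) →
               count (2 + h + h) (T ∘ cyclic (2 + h + h)) ≡ count (2 + h) T + count h (T ∘ suc)
count-cyclic h T = begin
  count (2 + h + h) (T ∘ cyclic m)
    ≡⟨ count-+ (2 + h) h (T ∘ cyclic m) ⟩
  count (2 + h) (T ∘ cyclic m) + count h (λ t → T (cyclic m (2 + h + t)))
    ≡⟨ cong₂ _+_ (count-cong (2 + h) (λ d d<2+h → cong T (first-half d (≤-pred d<2+h))))
                 (count-cong h (λ t t<h → cong T (second-half t t<h))) ⟩
  count (2 + h) T + count h (λ t → T (h ∸ t))
    ≡⟨ cong (count (2 + h) T +_) (count-reverse h T) ⟩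
  count (2 + h) T + count h (T ∘ suc)
    ∎
  where
  open ≡-Reasoning
  m = 2 + h + h
  first-half : ∀ d → d ≤ suc h → cyclic m d ≡ d
  first-half d d≤1+h = m≤n⇒m⊓n≡m (≤-trans d≤1+h (≤-trans (≤-reflexive half≡) (∸-monoʳ-≤ m d≤1+h)))
    where
    half≡ : suc h ≡ m ∸ suc h
    half≡ = sym (trans (cong (_∸ suc h) (sym (cong suc (+-suc h h)))) (m+n∸m≡n (suc h) (suc h)))
  second-half : ∀ t → t < h → cyclic m (2 + h + t) ≡ h ∸ t
  second-half t t<h = trans (cong ((2 + h + t) ⊓_) ([m+n]∸[m+o]≡n∸o (2 + h) h t))
                            (m≥n⇒m⊓n≡n (≤-trans (m∸n≤m h t) (≤-trans (m≤n+m h 2) (m≤m+n (2 + h) t))))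

spread : ℕ → ℕ → Bool → ℕ → Bool
spread h k odd zero    = false
spread h k odd (suc d) = (d <ᵇ k) ∨ (odd ∧ (h ≡ᵇ d))

count-spread : ∀ {h k} odd l → k ≤ l → k ≤ h →
               count l (spread h k odd ∘ suc) ≡ k + count l (λ d → odd ∧ (h ≡ᵇ d))
count-spread {h} {k} odd l k≤l k≤h =
  trans (count-∨ l (_<ᵇ k) (λ d → odd ∧ (h ≡ᵇ d)) disjoint) (cong (_+ _) (count-<ᵇ k≤l))
  where
  disjoint : ∀ d → (d <ᵇ k) ≡ true → (odd ∧ (h ≡ᵇ d)) ≡ false
  disjoint d d<ᵇk = trans (cong (odd ∧_) (dec-false (h ≟ d) λ { refl → <⇒≱ d<k k≤h })) (∧-zeroʳ odd)
    where
    d<k : d < k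
    d<k = <ᵇ⇒< d k (Equivalence.from T-≡ d<ᵇk)

count-antipode : ∀ odd h → count (suc h) (λ d → odd ∧ (h ≡ᵇ d)) ≡ ⟦ odd ⟧
count-antipode true  h = count-≡ᵇ {h} ≤-refl
count-antipode false h = count-false (suc h)

count-antipode-below : ∀ odd h → count h (λ d → odd ∧ (h ≡ᵇ d)) ≡ 0
count-antipode-below true  h = count-≡ᵇ-outside {h} ≤-refl
count-antipode-below false h = count-false h

spread-regular : ∀ h k odd → k ≤ h →
                 RegularOn (2 + h + h) (k + ⟦ odd ⟧ + k) (circulant (2 + h + h) (spread h k odd))
spread-regular h k odd k≤h p p<m = begin
  count (2 + h + h) (circulant (2 + h + h) T p)
    ≡⟨ count-circulant (2 + h + h) T p p<m ⟩
  count (2 + h + h) (T ∘ cyclic (2 + h + h))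
    ≡⟨ count-cyclic h T ⟩
  count (suc h) (T ∘ suc) + count h (T ∘ suc)
    ≡⟨ cong₂ _+_ (count-spread odd (suc h) (≤-trans k≤h (n≤1+n h)) k≤h)
                 (count-spread odd h k≤h k≤h) ⟩
  (k + count (suc h) (λ d → odd ∧ (h ≡ᵇ d))) + (k + count h (λ d → odd ∧ (h ≡ᵇ d)))
    ≡⟨ cong₂ _+_ (cong (k +_) (count-antipode odd h))
                 (trans (cong (k +_) (count-antipode-below odd h)) (+-identityʳ k)) ⟩
  k + ⟦ odd ⟧ + k
    ∎
  where
  open ≡-Reasoning
  T = spread h k odd

partner : ℕ → ℕ
partner 0             = 1
partner 1             = 0
partner (suc (suc p)) = suc (suc (partner p))

partner-involutive : ∀ p → partner (partner p) ≡ p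
partner-involutive 0             = refl
partner-involutive 1             = refl
partner-involutive (suc (suc p)) = cong (suc ∘ suc) (partner-involutive p)

∣p-partner[p]∣≡1 : ∀ p → ∣ p - partner p ∣ ≡ 1
∣p-partner[p]∣≡1 0             = refl
∣p-partner[p]∣≡1 1             = refl
∣p-partner[p]∣≡1 (suc (suc p)) = ∣p-partner[p]∣≡1 p

partner-< : ∀ h p → p < 2 + h + h → partner p < 2 + h + h
partner-< h       0             _                = s≤s (s≤s z≤n)
partner-< h       1             _                = s≤s z≤n
partner-< zero    (suc (suc p)) (s≤s (s≤s ()))
partner-< (suc h) (suc (suc p)) (s≤s (s≤s p<)) =
  s≤s (s≤s (subst (partner p <_) (sym m≡) (partner-< h p (subst (p <_) m≡ p<))))
  where
  m≡ : suc h + suc h ≡ 2 + h + h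
  m≡ = cong suc (+-suc h h)

partner≢ : ∀ p → partner p ≢ p
partner≢ 0             ()
partner≢ 1             ()
partner≢ (suc (suc p)) eq = partner≢ p (suc-injective (suc-injective eq))

pairing : ℕ → ℕ → Bool
pairing p q = partner p ≡ᵇ q

pairing-simple : Simple pairing
pairing-simple = record
  { symmetric   = symmetric
  ; irreflexive = λ p → dec-false (partner p ≟ p) (partner≢ p)
  }
  where
  symmetric : ∀ p q → pairing p q ≡ pairing q p
  symmetric p q with partner p ≟ q
  ... | yes refl =
    trans (≡ᵇ-refl (partner p)) (sym (trans (cong (_≡ᵇ p) (partner-involutive p)) (≡ᵇ-refl p)))
  ... | no  p′≢q = trans (dec-false (partner p ≟ q) p′≢q)
                         (sym (dec-false (partner q ≟ p) λ { refl → p′≢q (partner-involutive q) }))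

pairing⇒cyclic≡1 : ∀ h p q → pairing p q ≡ true → cyclic (2 + h + h) ∣ p - q ∣ ≡ 1
pairing⇒cyclic≡1 h p q p~q with ≡ᵇ⇒≡ (partner p) q (Equivalence.from T-≡ p~q)
... | refl = cong (cyclic (2 + h + h)) (∣p-partner[p]∣≡1 p)

pairing⊆circulant : ∀ h T → T 1 ≡ true → pairing ⊆ᴬ circulant (2 + h + h) T
pairing⊆circulant h T T1 p q p~q = trans (cong T (pairing⇒cyclic≡1 h p q p~q)) T1

ladder : ℕ → ℕ → ℕ → Bool
ladder m = pairing ∪ᴬ circulant m (2 ≡ᵇ_)

ladder-simple : ∀ m → Simple (ladder m)
ladder-simple m = ∪ᴬ-simple pairing-simple (circulant-simple m (2 ≡ᵇ_) refl)

ladder-regular : ∀ h → 2 ≤ h → RegularOn (2 + h + h) 3 (ladder (2 + h + h))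
ladder-regular h 2≤h p p<m = begin
  count m (λ q → pairing p q ∨ circulant m (2 ≡ᵇ_) p q)
    ≡⟨ count-∨ m (pairing p) (circulant m (2 ≡ᵇ_) p) matched-at-distance-1 ⟩
  count m (partner p ≡ᵇ_) + count m (circulant m (2 ≡ᵇ_) p)
    ≡⟨ cong₂ _+_ (count-≡ᵇ (partner-< h p p<m)) (count-circulant m (2 ≡ᵇ_) p p<m) ⟩
  1 + count m ((2 ≡ᵇ_) ∘ cyclic m)
    ≡⟨ cong suc (count-cyclic h (2 ≡ᵇ_)) ⟩
  1 + (count (2 + h) (2 ≡ᵇ_) + count h (1 ≡ᵇ_))
    ≡⟨ cong suc (cong₂ _+_ (count-≡ᵇ (s≤s (s≤s (≤-trans (s≤s z≤n) 2≤h)))) (count-≡ᵇ 2≤h)) ⟩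
  3 ∎
  where
  open ≡-Reasoning
  m = 2 + h + h
  matched-at-distance-1 : ∀ q → pairing p q ≡ true → circulant m (2 ≡ᵇ_) p q ≡ false
  matched-at-distance-1 q p~q = cong (2 ≡ᵇ_) (pairing⇒cyclic≡1 h p q p~q)

record RegularWithCubicFactor (m r : ℕ) : Set where
  field
    graph factor   : ℕ → ℕ → Bool
    graph-simple   : Simple graph
    factor-simple  : Simple factor
    graph-regular  : RegularOn m r graph
    factor-regular : RegularOn m 3 factor
    factor⊆graph   : factor ⊆ᴬ graph

halve : ∀ r → ∃ λ k → ∃ λ odd → r ≡ k + ⟦ odd ⟧ + k
halve 0             = 0 , false , refl
halve 1             = 0 , true  , refl
halve (suc (suc r)) with halve r
... | k , odd , refl = suc k , odd , cong suc (sym (+-suc (k + ⟦ odd ⟧) k))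

k+b+k<2+h+h⇒k≤h : ∀ {k b h} → k + b + k < 2 + h + h → k ≤ h
k+b+k<2+h+h⇒k≤h {k} {b} {h} k+b+k<m = ≮⇒≥ λ h<k → <⇒≱ k+b+k<m (begin
  2 + h + h     ≡⟨ cong suc (sym (+-suc h h)) ⟩
  suc h + suc h ≤⟨ +-mono-≤ h<k h<k ⟩
  k + k         ≤⟨ +-monoˡ-≤ k (m≤m+n k b) ⟩
  k + b + k     ∎)
  where open ≤-Reasoning

spread-withCubicFactor : ∀ h k odd → 3 ≤ k + ⟦ odd ⟧ + k → k ≤ h →
                         RegularWithCubicFactor (2 + h + h) (k + ⟦ odd ⟧ + k)
spread-withCubicFactor h 0 false () _
spread-withCubicFactor h 0 true  (s≤s ()) _
spread-withCubicFactor h 1 false (s≤s (s≤s ())) _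
spread-withCubicFactor h 1 true _ 1≤h = record
  { graph          = circulant (2 + h + h) (spread h 1 true)
  ; factor         = circulant (2 + h + h) (spread h 1 true)
  ; graph-simple   = circulant-simple (2 + h + h) (spread h _ _) refl
  ; factor-simple  = circulant-simple (2 + h + h) (spread h _ _) refl
  ; graph-regular  = spread-regular h 1 true 1≤h
  ; factor-regular = spread-regular h 1 true 1≤h
  ; factor⊆graph   = λ _ _ e → e
  }
spread-withCubicFactor h k@(suc (suc _)) odd _ k≤h = record
  { graph          = circulant (2 + h + h) (spread h k odd)
  ; factor         = ladder (2 + h + h)
  ; graph-simple   = circulant-simple (2 + h + h) (spread h _ _) refl
  ; factor-simple  = ladder-simple (2 + h + h)
  ; graph-regular  = spread-regular h k odd k≤h
  ; factor-regular = ladder-regular h (≤-trans (s≤s (s≤s z≤n)) k≤h)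
  ; factor⊆graph   = ∪ᴬ-⊆ (pairing⊆circulant h (spread h k odd) refl) (circulant-mono (2 + h + h) distance-2)
  }
  where
  distance-2 : ∀ d → (2 ≡ᵇ d) ≡ true → spread h k odd d ≡ true
  distance-2 d 2≡d with ≡ᵇ⇒≡ 2 d (Equivalence.from T-≡ 2≡d)
  ... | refl = refl

regularWithCubicFactor : ∀ h r → 3 ≤ r → r < 2 + h + h → RegularWithCubicFactor (2 + h + h) r
regularWithCubicFactor h r 3≤r r<m with halve r
... | k , odd , refl = spread-withCubicFactor h k odd 3≤r (k+b+k<2+h+h⇒k≤h r<m)

data Block : Set where
  hub mid leaf : Block

classify : Bool → Bool → Block
classify true  _     = hub
classify false true  = mid
classify false false = leaf

-- The same tests as in dSeq, so that dSeq≡blockDegree holds by computation.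
block : ℕ → ℕ → Block
block m i = classify (does (i <? 3)) (does (i <? 3 + m))

block-hub⁻ : ∀ m {i} → block m i ≡ hub → i < 3
block-hub⁻ m {i} = classify-hub⁻ (i <? 3) (i <? 3 + m)
  where
  classify-hub⁻ : ∀ {P Q : Set} (p? : Dec P) (q? : Dec Q) → classify (does p?) (does q?) ≡ hub → P
  classify-hub⁻ (yes p) _       _  = p
  classify-hub⁻ (no _)  (yes _) ()
  classify-hub⁻ (no _)  (no _)  ()

block-mid⁻ : ∀ m {i} → block m i ≡ mid → i ∸ 3 < m
block-mid⁻ m {i} = classify-mid⁻ (i <? 3) (i <? 3 + m)
  where
  classify-mid⁻ : (p? : Dec (i < 3)) (q? : Dec (i < 3 + m)) →
                  classify (does p?) (does q?) ≡ mid → i ∸ 3 < m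
  classify-mid⁻ (no i≮3) (yes i<3+m) _ = ∸-monoˡ-< i<3+m (≮⇒≥ i≮3)
  classify-mid⁻ (yes _)  _           ()
  classify-mid⁻ (no _)   (no _)      ()

block-hub : ∀ m {i} → i < 3 → block m i ≡ hub
block-hub m {i} i<3 rewrite dec-true (i <? 3) i<3 = refl

block-mid : ∀ m {t} → t < m → block m (3 + t) ≡ mid
block-mid m {t} t<m rewrite dec-true (t <? m) t<m = refl

block-leaf : ∀ m t → block m (3 + m + t) ≡ leaf
block-leaf m t rewrite dec-false (m + t <? m) (≤⇒≯ (m≤m+n m t)) = refl

count-by-block : ∀ m (f : Block → ℕ → Bool) →
  count (6 + m) (λ t → f (block m t) t)
    ≡ count 3 (f hub) + (count m (λ t → f mid (3 + t)) + count 3 (λ t → f leaf (3 + m + t)))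
count-by-block m f = begin
  count (6 + m) g
    ≡⟨ cong (λ n → count n g) (cong (3 +_) (+-comm 3 m)) ⟩
  count (3 + (m + 3)) g
    ≡⟨ count-+ 3 (m + 3) g ⟩
  count 3 g + count (m + 3) (λ t → g (3 + t))
    ≡⟨ cong (count 3 g +_) (count-+ m 3 (λ t → g (3 + t))) ⟩
  count 3 g + (count m (λ t → g (3 + t)) + count 3 (λ t → g (3 + m + t)))
    ≡⟨ cong₂ _+_ (count-cong 3 (λ t t<3 → cong (λ b → f b t) (block-hub m t<3)))
                 (cong₂ _+_ (count-cong m (λ t t<m → cong (λ b → f b (3 + t)) (block-mid m t<m)))
                            (count-cong 3 (λ t _ → cong (λ b → f b (3 + m + t)) (block-leaf m t)))) ⟩
  count 3 (f hub) + (count m (λ t → f mid (3 + t)) + count 3 (λ t → f leaf (3 + m + t)))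
    ∎
  where
  open ≡-Reasoning
  g : ℕ → Bool
  g t = f (block m t) t

blockDegree : ℕ → ℕ → Block → ℕ
blockDegree m x hub  = 5 + m
blockDegree m x mid  = x
blockDegree m x leaf = 3

dSeq≡blockDegree : ∀ m x i → dSeq (6 + m) x i ≡ blockDegree m x (block m (toℕ i))
dSeq≡blockDegree m x i with does (toℕ i <? 3) | does (toℕ i <? 3 + m)
... | true  | _     = refl
... | false | true  = refl
... | false | false = refl

graphEdge : (ℕ → ℕ → Bool) → ℕ → ℕ → Block → Block → Bool
graphEdge A i j hub hub = not (i ≡ᵇ j)
graphEdge A i j hub _   = true
graphEdge A i j _   hub = true
graphEdge A i j mid mid = A (i ∸ 3) (j ∸ 3)
graphEdge A i j _   _   = false

factorEdge : (ℕ → ℕ → Bool) → ℕ → ℕ → Block → Block → Bool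
factorEdge F i j hub  leaf = true
factorEdge F i j leaf hub  = true
factorEdge F i j mid  mid  = F (i ∸ 3) (j ∸ 3)
factorEdge F i j _    _    = false

blockGraph blockFactor : ℕ → (ℕ → ℕ → Bool) → ℕ → ℕ → Bool
blockGraph  m A i j = graphEdge  A i j (block m i) (block m j)
blockFactor m F i j = factorEdge F i j (block m i) (block m j)

graphEdge-sym : ∀ {A} → Simple A → ∀ i j b c → graphEdge A i j b c ≡ graphEdge A j i c b
graphEdge-sym _      i j hub  hub  = cong not (≡ᵇ-sym i j)
graphEdge-sym _      i j hub  mid  = refl
graphEdge-sym _      i j hub  leaf = refl
graphEdge-sym _      i j mid  hub  = refl
graphEdge-sym simple i j mid  mid  = Simple.symmetric simple (i ∸ 3) (j ∸ 3)
graphEdge-sym _      i j mid  leaf = refl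
graphEdge-sym _      i j leaf hub  = refl
graphEdge-sym _      i j leaf mid  = refl
graphEdge-sym _      i j leaf leaf = refl

factorEdge-sym : ∀ {F} → Simple F → ∀ i j b c → factorEdge F i j b c ≡ factorEdge F j i c b
factorEdge-sym _      i j hub  hub  = refl
factorEdge-sym _      i j hub  mid  = refl
factorEdge-sym _      i j hub  leaf = refl
factorEdge-sym _      i j mid  hub  = refl
factorEdge-sym simple i j mid  mid  = Simple.symmetric simple (i ∸ 3) (j ∸ 3)
factorEdge-sym _      i j mid  leaf = refl
factorEdge-sym _      i j leaf hub  = refl
factorEdge-sym _      i j leaf mid  = refl
factorEdge-sym _      i j leaf leaf = refl

graphEdge-loop : ∀ {A} → Simple A → ∀ i b → graphEdge A i i b b ≡ false
graphEdge-loop _      i hub  = cong not (≡ᵇ-refl i)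
graphEdge-loop simple i mid  = Simple.irreflexive simple (i ∸ 3)
graphEdge-loop _      i leaf = refl

factorEdge-loop : ∀ {F} → Simple F → ∀ i b → factorEdge F i i b b ≡ false
factorEdge-loop _      i hub  = refl
factorEdge-loop simple i mid  = Simple.irreflexive simple (i ∸ 3)
factorEdge-loop _      i leaf = refl

blockGraph-simple : ∀ m {A} → Simple A → Simple (blockGraph m A)
blockGraph-simple m simple = record
  { symmetric   = λ i j → graphEdge-sym simple i j (block m i) (block m j)
  ; irreflexive = λ i → graphEdge-loop simple i (block m i)
  }

blockFactor-simple : ∀ m {F} → Simple F → Simple (blockFactor m F)
blockFactor-simple m simple = record
  { symmetric   = λ i j → factorEdge-sym simple i j (block m i) (block m j)
  ; irreflexive = λ i → factorEdge-loop simple i (block m i)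
  }

blockFactor⊆blockGraph : ∀ m {A F} → F ⊆ᴬ A → blockFactor m F ⊆ᴬ blockGraph m A
blockFactor⊆blockGraph m {A} {F} F⊆A i j = go (block m i) (block m j)
  where
  go : ∀ b c → factorEdge F i j b c ≡ true → graphEdge A i j b c ≡ true
  go hub  leaf _ = refl
  go leaf hub  _ = refl
  go mid  mid  e = F⊆A (i ∸ 3) (j ∸ 3) e
  go hub  hub  ()
  go hub  mid  ()
  go mid  hub  ()
  go mid  leaf ()
  go leaf mid  ()
  go leaf leaf ()

blockGraph-degree : ∀ m {r A} → RegularOn m r A → ∀ i →
                    count (6 + m) (blockGraph m A i) ≡ blockDegree m (3 + r) (block m i)
blockGraph-degree m {r} {A} A-regular i = go (block m i) refl
  where
  other-hubs : i < 3 → count 3 (λ t → not (i ≡ᵇ t)) ≡ 2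
  other-hubs (s≤s z≤n)             = refl
  other-hubs (s≤s (s≤s z≤n))       = refl
  other-hubs (s≤s (s≤s (s≤s z≤n))) = refl

  go : ∀ b → block m i ≡ b →
       count (6 + m) (λ t → graphEdge A i t b (block m t)) ≡ blockDegree m (3 + r) b
  go hub  eq = trans (count-by-block m (λ c t → graphEdge A i t hub c))
                     (cong₂ _+_ (other-hubs (block-hub⁻ m {i} eq))
                                (trans (cong (_+ 3) (count-true m)) (+-comm m 3)))
  go mid  eq = trans (count-by-block m (λ c t → graphEdge A i t mid c))
                     (cong (3 +_) (trans (cong (_+ 0) (A-regular (i ∸ 3) (block-mid⁻ m {i} eq)))
                                         (+-identityʳ r)))
  go leaf _  = trans (count-by-block m (λ c t → graphEdge A i t leaf c))
                     (cong (λ z → 3 + (z + 0)) (count-false m))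

blockFactor-degree : ∀ m {F} → RegularOn m 3 F → ∀ i → count (6 + m) (blockFactor m F i) ≡ 3
blockFactor-degree m {F} F-regular i = go (block m i) refl
  where
  go : ∀ b → block m i ≡ b → count (6 + m) (λ t → factorEdge F i t b (block m t)) ≡ 3
  go hub  _  = trans (count-by-block m (λ c t → factorEdge F i t hub c))
                     (cong (_+ 3) (count-false m))
  go mid  eq = trans (count-by-block m (λ c t → factorEdge F i t mid c))
                     (cong (_+ 0) (F-regular (i ∸ 3) (block-mid⁻ m {i} eq)))
  go leaf _  = trans (count-by-block m (λ c t → factorEdge F i t leaf c))
                     (cong (λ z → 3 + (z + 0)) (count-false m))

blockGraph-factorable : ∀ {m r} → RegularWithCubicFactor m r → Factorable 3 (dSeq (6 + m) (3 + r))
blockGraph-factorable {m} {r} middle = G , realizes , H , H⊆G , H-regular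
  where
  open RegularWithCubicFactor middle

  G-simple : Simple (blockGraph m graph)
  G-simple = blockGraph-simple m graph-simple
  H-simple : Simple (blockFactor m factor)
  H-simple = blockFactor-simple m factor-simple

  G H : Graph (6 + m)
  G = toGraph (6 + m) (blockGraph m graph) G-simple
  H = toGraph (6 + m) (blockFactor m factor) H-simple

  realizes : Realizes G (dSeq (6 + m) (3 + r))
  realizes i = begin
    deg G i                                    ≡⟨ deg-toGraph (blockGraph m graph) G-simple i ⟩
    count (6 + m) (blockGraph m graph (toℕ i)) ≡⟨ blockGraph-degree m graph-regular (toℕ i) ⟩
    blockDegree m (3 + r) (block m (toℕ i))    ≡⟨ sym (dSeq≡blockDegree m (3 + r) i) ⟩
    dSeq (6 + m) (3 + r) i                     ∎
    where open ≡-Reasoning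

  H⊆G : H ⊆G G
  H⊆G i j = blockFactor⊆blockGraph m factor⊆graph (toℕ i) (toℕ j)

  H-regular : Regular 3 H
  H-regular i = trans (deg-toGraph (blockFactor m factor) H-simple i)
                      (blockFactor-degree m factor-regular (toℕ i))

∈tabulate⁺ : ∀ {n} {f : Fin n → Bool} {j} → f j ≡ true → j ∈ tabulate f
∈tabulate⁺ {f = f} {j} e = lookup⇒[]= j (tabulate f) (trans (lookup∘tabulate f j) e)

∈tabulate⁻ : ∀ {n} {f : Fin n → Bool} {j} → j ∈ tabulate f → f j ≡ true
∈tabulate⁻ {f = f} {j} j∈ = trans (sym (lookup∘tabulate f j)) ([]=⇒lookup j∈)

p⊆q∧∣q∣≤∣p∣⇒q⊆p : ∀ {n} {p q : Subset n} → p ⊆ q → ∣ q ∣ ≤ ∣ p ∣ → q ⊆ p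
p⊆q∧∣q∣≤∣p∣⇒q⊆p {p = p} p⊆q ∣q∣≤∣p∣ {x} x∈q with x ∈? p
... | yes x∈p = x∈p
... | no  x∉p = contradiction (p⊂q⇒∣p∣<∣q∣ (p⊆q , x , x∈q , x∉p)) (≤⇒≯ ∣q∣≤∣p∣)

full-degree⇒adj : ∀ {n} (G : Graph n) {u} → deg G u ≡ n ∸ 1 → ∀ {j} → j ≢ u → adj G u j ≡ true
full-degree⇒adj {n} G {u} deg≡ j≢u =
  ∈tabulate⁻ (p⊆q∧∣q∣≤∣p∣⇒q⊆p nbhd⊆others others≤deg (x∉p⇒x∈∁p (x≢y⇒x∉⁅y⁆ j≢u)))
  where
  nbhd⊆others : nbhd G u ⊆ ∁ ⁅ u ⁆
  nbhd⊆others {j} j∈ = x∉p⇒x∈∁p λ j∈⁅u⁆ →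
    contradiction (trans (sym (loopless G u))
                         (subst (λ k → adj G u k ≡ true) (x∈⁅y⁆⇒x≡y u j∈⁅u⁆) (∈tabulate⁻ j∈))) λ ()
  others≤deg : ∣ ∁ ⁅ u ⁆ ∣ ≤ deg G u
  others≤deg = ≤-reflexive (trans (∣∁p∣≡n∸∣p∣ ⁅ u ⁆) (trans (cong (n ∸_) (∣⁅x⁆∣≡1 u)) (sym deg≡)))

module FactorConfinement {n k} (G H : Graph n) (H⊆G : H ⊆G G) (H-regular : Regular k H)
  {U W : Subset n} (∣U∣≡k : ∣ U ∣ ≡ k) (∣W∣≡k : ∣ W ∣ ≡ k) (W∩U≡∅ : ∀ {w} → w ∈ W → w ∉ U)
  (U-full : ∀ {u} → u ∈ U → deg G u ≡ n ∸ 1) (W-degree : ∀ {w} → w ∈ W → deg G w ≡ k) where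

  nbhd-leaf⊆hubs : ∀ {w} → w ∈ W → nbhd G w ⊆ U
  nbhd-leaf⊆hubs {w} w∈W =
    p⊆q∧∣q∣≤∣p∣⇒q⊆p hubs⊆nbhd (≤-reflexive (trans (W-degree w∈W) (sym ∣U∣≡k)))
    where
    hubs⊆nbhd : U ⊆ nbhd G w
    hubs⊆nbhd {u} u∈U = ∈tabulate⁺ (trans (Graph.sym G w u)
      (full-degree⇒adj G (U-full u∈U) λ w≡u → W∩U≡∅ w∈W (subst (_∈ U) (sym w≡u) u∈U)))

  hubs⊆factor-nbhd-leaf : ∀ {w} → w ∈ W → U ⊆ nbhd H w
  hubs⊆factor-nbhd-leaf {w} w∈W =
    p⊆q∧∣q∣≤∣p∣⇒q⊆p (λ u∈ → nbhd-leaf⊆hubs w∈W (∈tabulate⁺ (H⊆G w _ (∈tabulate⁻ u∈))))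
                    (≤-reflexive (trans ∣U∣≡k (sym (H-regular w))))

  factor-nbhd-hub⊆leaves : ∀ {u} → u ∈ U → nbhd H u ⊆ W
  factor-nbhd-hub⊆leaves {u} u∈U =
    p⊆q∧∣q∣≤∣p∣⇒q⊆p leaves⊆nbhd (≤-reflexive (trans (H-regular u) (sym ∣W∣≡k)))
    where
    leaves⊆nbhd : W ⊆ nbhd H u
    leaves⊆nbhd {w} w∈W =
      ∈tabulate⁺ (trans (Graph.sym H u w) (∈tabulate⁻ (hubs⊆factor-nbhd-leaf w∈W u∈U)))

  walk-confined : ∀ {a b} → Walk H a b → a ∈ U ⊎ a ∈ W → b ∈ U ⊎ b ∈ W
  walk-confined here          a∈U⊎W      = a∈U⊎W
  walk-confined (step e walk) (inj₁ a∈U) =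
    walk-confined walk (inj₂ (factor-nbhd-hub⊆leaves a∈U (∈tabulate⁺ e)))
  walk-confined (step e walk) (inj₂ a∈W) =
    walk-confined walk (inj₁ (nbhd-leaf⊆hubs a∈W (∈tabulate⁺ (H⊆G _ _ e))))

isHub isLeaf : Block → Bool
isHub hub   = true
isHub _     = false
isLeaf leaf = true
isLeaf _    = false

isHub⁻ : ∀ {b} → isHub b ≡ true → b ≡ hub
isHub⁻ {hub} _ = refl

isLeaf⁻ : ∀ {b} → isLeaf b ≡ true → b ≡ leaf
isLeaf⁻ {leaf} _ = refl

noConnectedCubicFactor : ∀ m x → 0 < m → NoConnectedFactor 3 (dSeq (6 + m) x)
noConnectedCubicFactor m x 0<m G realizes (H , H⊆G , H-regular , connected) =
  [ middle∉hubs , middle∉leaves ]′ (walk-confined (connected fzero middle) (inj₁ fzero∈hubs))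
  where
  inBlock : (Block → Bool) → Subset (6 + m)
  inBlock p = tabulate (λ j → p (block m (toℕ j)))

  ∈inBlock⁻ : ∀ p {j} → j ∈ inBlock p → p (block m (toℕ j)) ≡ true
  ∈inBlock⁻ p = ∈tabulate⁻ {f = λ j → p (block m (toℕ j))}

  ∣inBlock∣ : ∀ p → ∣ inBlock p ∣ ≡
                    count 3 (λ _ → p hub) + (count m (λ _ → p mid) + count 3 (λ _ → p leaf))
  ∣inBlock∣ p = trans (∣tabulate∣≡count (6 + m) (p ∘ block m)) (count-by-block m (λ b _ → p b))

  hubs leaves : Subset (6 + m)
  hubs   = inBlock isHub
  leaves = inBlock isLeaf

  hub-degree : ∀ {u} → u ∈ hubs → deg G u ≡ 5 + m
  hub-degree {u} u∈U = trans (realizes u)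
    (trans (dSeq≡blockDegree m x u) (cong (blockDegree m x) (isHub⁻ (∈inBlock⁻ isHub u∈U))))

  leaf-degree : ∀ {w} → w ∈ leaves → deg G w ≡ 3
  leaf-degree {w} w∈W = trans (realizes w)
    (trans (dSeq≡blockDegree m x w) (cong (blockDegree m x) (isLeaf⁻ (∈inBlock⁻ isLeaf w∈W))))

  leaf∉hubs : ∀ {w} → w ∈ leaves → w ∉ hubs
  leaf∉hubs w∈W w∈U with trans (sym (isHub⁻ (∈inBlock⁻ isHub w∈U))) (isLeaf⁻ (∈inBlock⁻ isLeaf w∈W))
  ... | ()

  open FactorConfinement G H H⊆G H-regular
    (trans (∣inBlock∣ isHub) (cong (λ z → 3 + (z + 0)) (count-false m)))
    (trans (∣inBlock∣ isLeaf) (cong (_+ 3) (count-false m)))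
    leaf∉hubs hub-degree leaf-degree

  middle : Fin (6 + m)
  middle = fsuc (fsuc (fsuc fzero))

  fzero∈hubs : fzero ∈ hubs
  fzero∈hubs = ∈tabulate⁺ {f = λ j → isHub (block m (toℕ j))} refl

  middle∉hubs : middle ∉ hubs
  middle∉hubs middle∈U with trans (sym (block-mid m 0<m)) (isHub⁻ (∈inBlock⁻ isHub middle∈U))
  ... | ()

  middle∉leaves : middle ∉ leaves
  middle∉leaves middle∈W with trans (sym (block-mid m 0<m)) (isLeaf⁻ (∈inBlock⁻ isLeaf middle∈W))
  ... | ()

factorable⇒graphic : ∀ {n k} {d : Fin n → ℕ} → Factorable k d → Graphic d
factorable⇒graphic (G , realizes , _) = G , realizes

Claim : ℕ → ℕ → Set
Claim n x = Graphic (dSeq n x) × Factorable 3 (dSeq n x) × NoConnectedFactor 3 (dSeq n x)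

claim-normalised : ∀ h r → 3 ≤ r → r < 2 + h + h → Claim (6 + (2 + h + h)) (3 + r)
claim-normalised h r 3≤r r<m =
  factorable⇒graphic factorable , factorable , noConnectedCubicFactor (2 + h + h) (3 + r) (s≤s z≤n)
  where
  factorable = blockGraph-factorable (regularWithCubicFactor h r 3≤r r<m)

claim1 : (n x : ℕ) → ∃ (λ m → n ≡ 2 * m) → 6 ≤ x → x + 4 ≤ n →
    Graphic (dSeq n x) × Factorable 3 (dSeq n x) × NoConnectedFactor 3 (dSeq n x)
claim1 n x (j , n≡2j) 6≤x x+4≤n = subst₂ Claim (sym n≡) (sym x≡) (claim-normalised h r 3≤r r<m)
  where
  r = x ∸ 3
  h = j ∸ 4

  double : ∀ h → 2 * (4 + h) ≡ 6 + (2 + h + h)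
  double = solve-∀

  shift : ∀ r → 3 + r + 4 ≡ 6 + suc r
  shift = solve-∀

  3≤x : 3 ≤ x
  3≤x = ≤-trans (s≤s (s≤s (s≤s z≤n))) 6≤x

  x≡ : x ≡ 3 + r
  x≡ = sym (m+[n∸m]≡n 3≤x)

  4≤j : 4 ≤ j
  4≤j = ≮⇒≥ λ j<4 → <⇒≱ (≤-trans (s≤s (*-monoʳ-≤ 2 (≤-pred j<4))) (+-monoˡ-≤ 4 3≤x))
                        (subst (x + 4 ≤_) n≡2j x+4≤n)

  n≡ : n ≡ 6 + (2 + h + h)
  n≡ = trans n≡2j (trans (cong (2 *_) (sym (m+[n∸m]≡n 4≤j))) (double h))

  3≤r : 3 ≤ r
  3≤r = ∸-monoˡ-≤ 3 6≤x

  r<m : r < 2 + h + h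
  r<m = +-cancelˡ-≤ 6 _ _ (subst₂ _≤_ (trans (cong (_+ 4) x≡) (shift r)) n≡ x+4≤n)
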